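{- Let $J_1,\dots,J_r$ be a strong right-descent sequence of subsets of $S$ and let $w=w(J_1,\dots,J_r)$. Then for integers $a<b$, $[a,b]$ is a right-descent interval of $w$ if and only if there exists $e\in H(J)$ such that $[a,b]\subseteq[i_e,j_e]$ and $[a,b]\cap[i_f,j_f]=\emptyset$ for every $f\in H(J)$ with $\mathrm{lvl}(f)>\mathrm{lvl}(e)$. In particular, $[a,b]$ is a strong right-descent interval of $w$ if and only if there exists $e\in H(J)$ such that neither $e+\vec u_1$ nor $e+\vec u_2$ exists and $[i_e,j_e]=[a,b]$.
   Context: Permutations $w\in S_n$ act on positions with $(wv)(p)=w(v(p))$; $S=\{s_1,\dots,s_{n-1}\}$, $s_i$ swapping $i,i+1$; $W_K$ generated by $K\subseteq S$. A connected component of $K$ is a maximal $\{s_a,\dots,s_{b-1}\}$ ($a<b$), with position interval $[a,b]$. $w(J_1,\dots,J_0)=\mathrm{id}$ and $w(J_1,\dots,J_k)$ is the maximal-length element of $w(J_1,\dots,J_{k-1})W_{J_k}$. An interval $[a,b]$ ($a<b$) is a right-descent interval of $w$ if $w(a)>w(a+1)>\dots>w(b)$. $\lambda_w(p)$ is the position $q\le p$ maximizing $w(q)$, $\rho_w(p)$ the position $q\ge p$ minimizing $w(q)$. A right-descent interval $[a,b]$ is strong if $\lambda_w(a)=a$ and $\rho_w(b)=b$. The sequence $J$ is strong right-descent if for every $k$, every component interval of $J_k$ is a strong right-descent interval of $w(J_1,\dots,J_k)$. Heap: $H(J)$ is the disjoint union over $k$ of the connected components of $J_k$; for $f\in H(J)$,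 $[i_f,j_f]$ is its interval and $\mathrm{lvl}(f)=k$ if $f$ is a component of $J_k$. $f+\vec u_1$ is the (unique, if existing) $h$ with $\mathrm{lvl}(h)>\mathrm{lvl}(f)$, $j_f\in[i_h,j_h]$, and $j_f\notin[i_g,j_g]$ for all $g$ with $\mathrm{lvl}(f)<\mathrm{lvl}(g)<\mathrm{lvl}(h)$; $f+\vec u_2$ is defined likewise with $i_f$ in place of $j_f$. -}

module Defs where

open import Data.Nat using (ℕ; zero; suc; _+_; _∸_; _≤_; _<_; _<?_)
open import Data.List using (List; []; _∷_; length; filter; applyUpTo)
open import Data.List.Membership.Propositional using (_∈_)
open import Data.Product using (Σ; _×_; _,_; ∃)
open import Relation.Nullary using (¬_)
open import Relation.Binary.PropositionalEquality using (_≡_)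
open import Function.Bundles using (_⇔_)

-- Permutations of S_n in one-line notation: w is the list
-- [w(1), w(2), ..., w(n)].  Positions are 1-indexed.

-- value w(p) at position p (1 ≤ p ≤ n); 0 outside the range
val : List ℕ → ℕ → ℕ
val []       _             = 0
val (x ∷ xs) zero          = 0
val (x ∷ xs) (suc zero)    = x
val (x ∷ xs) (suc (suc p)) = val xs (suc p)

idPerm : ℕ → List ℕ
idPerm n = applyUpTo suc n

-- right multiplication by s_i: (w s_i)(p) = w(s_i(p)), i.e. swap the
-- entries in positions i and i+1
swapAt : ℕ → List ℕ → List ℕ
swapAt zero          xs           = xs
swapAt (suc zero)    (x ∷ y ∷ xs) = y ∷ x ∷ xs
swapAt (suc zero)    xs           = xs
swapAt (suc (suc i)) []           = []
swapAt (suc (suc i)) (x ∷ xs)     = x ∷ swapAt (suc i) xs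

-- Coxeter length of a permutation = number of inversions
len : List ℕ → ℕ
len []       = 0
len (x ∷ xs) = length (filter (λ y → y <? x) xs) + len xs

-- Subsets K ⊆ S are lists of indices i (standing for s_i), 1 ≤ i ≤ n-1.

IsSubsetOfS : ℕ → List ℕ → Set
IsSubsetOfS n K = ∀ i → i ∈ K → 1 ≤ i × suc i ≤ n

-- u ∈ v W_K  (W_K generated by the s_i, i ∈ K; as W_K is finite and
-- s_i² = 1 it is the monoid generated by these s_i)
data InCoset (K : List ℕ) (v : List ℕ) : List ℕ → Set where
  here : InCoset K v v
  step : ∀ {u i} → InCoset K v u → i ∈ K → InCoset K v (swapAt i u)

IsMaxInCoset : List ℕ → List ℕ → List ℕ → Set
IsMaxInCoset K v u = InCoset K v u × (∀ x → InCoset K v x → len x ≤ len u)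

-- W k = w(J_1,...,J_k) for 0 ≤ k ≤ r
IsWChain : ℕ → (J : ℕ → List ℕ) → ℕ → (W : ℕ → List ℕ) → Set
IsWChain n J r W =
  (W 0 ≡ idPerm n) ×
  (∀ k → 1 ≤ k → k ≤ r → IsMaxInCoset (J k) (W (k ∸ 1)) (W k))

-- Connected components of K: maximal {s_a,...,s_{b-1}} ⊆ K, interval [a,b]

IsComponent : List ℕ → ℕ → ℕ → Set
IsComponent K a b =
  (a < b) ×
  (∀ i → a ≤ i → i < b → i ∈ K) ×
  (∀ i → suc i ≡ a → ¬ (i ∈ K)) ×
  ¬ (b ∈ K)

IsRightDescentInterval : ℕ → List ℕ → ℕ → ℕ → Set
IsRightDescentInterval n w a b =
  (a < b) × (1 ≤ a) × (b ≤ n) ×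
  (∀ p → a ≤ p → p < b → val w (suc p) < val w p)

IsLambda : List ℕ → ℕ → ℕ → Set
IsLambda w p q = (1 ≤ q) × (q ≤ p) × (∀ q′ → 1 ≤ q′ → q′ ≤ p → val w q′ ≤ val w q)

IsRho : ℕ → List ℕ → ℕ → ℕ → Set
IsRho n w p q = (p ≤ q) × (q ≤ n) × (∀ q′ → p ≤ q′ → q′ ≤ n → val w q ≤ val w q′)

IsStrongRightDescentInterval : ℕ → List ℕ → ℕ → ℕ → Set
IsStrongRightDescentInterval n w a b =
  IsRightDescentInterval n w a b × IsLambda w a a × IsRho n w b b

IsStrongRightDescentSeq : ℕ → (J : ℕ → List ℕ) → ℕ → (W : ℕ → List ℕ) → Set
IsStrongRightDescentSeq n J r W =
  ∀ k → 1 ≤ k → k ≤ r → ∀ a b → IsComponent (J k) a b →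
    IsStrongRightDescentInterval n (W k) a b

-- The heap H(J): elements are (level k, interval [i,j]) with [i,j] the
-- interval of a component of J_k, 1 ≤ k ≤ r.

record Node : Set where
  constructor node
  field
    lvl : ℕ
    ival : ℕ
    jval : ℕ
open Node public

InHeap : (J : ℕ → List ℕ) → ℕ → Node → Set
InHeap J r f = (1 ≤ lvl f) × (lvl f ≤ r) × IsComponent (J (lvl f)) (ival f) (jval f)

InIval : ℕ → Node → Set
InIval p f = (ival f ≤ p) × (p ≤ jval f)

-- h = f + u⃗ at the endpoint p (p = j_f for u⃗₁, p = i_f for u⃗₂)
IsShiftAt : (J : ℕ → List ℕ) → ℕ → ℕ → Node → Node → Set
IsShiftAt J r p f h =
  InHeap J r h × (lvl f < lvl h) × InIval p h ×
  (∀ g → InHeap J r g → lvl f < lvl g → lvl g < lvl h → ¬ InIval p g)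

U1Exists : (J : ℕ → List ℕ) → ℕ → Node → Set
U1Exists J r f = ∃ λ h → IsShiftAt J r (jval f) f h

U2Exists : (J : ℕ → List ℕ) → ℕ → Node → Set
U2Exists J r f = ∃ λ h → IsShiftAt J r (ival f) f h

{-# OPTIONS --safe #-}
-- W k arises from W (k - 1) by permuting positions inside the component intervals of J k.
-- Hence a position keeps its value through every level not touching it (containing neither
-- s_{q-1} nor s_q), and an interval whose boundary no level crosses keeps its set of values.
-- Strongness makes W k decreasing on each component interval of J k, with the left end a
-- prefix maximum and the right end a suffix minimum. So p is a descent of W r exactly when
-- the last level touching p or p + 1 contains s_p; a descent interval therefore lies in one
-- component e of one level, untouched afterwards. For strong intervals the prefix maximum
-- at a and suffix minimum at b transfer between W r and W (lvl e), which forces [a, b] to be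
-- the whole of e. Conversely, if e has no shifts its endpoints are untouched later, and
-- induction on the level excludes any later component inside e: its left end would have to
-- be a prefix maximum, yet carries a value that W (lvl e) placed below the value at i_e.
module Submission where

open import Defs
open import Data.Nat
open import Data.Nat.Properties
open import Data.Nat.Induction using (<-rec)
open import Data.List using (List; []; _∷_; length; applyUpTo)
open import Data.List.Properties using (length-applyUpTo)
open import Data.List.Membership.Propositional using (_∈_)
open import Data.List.Membership.DecPropositional _≟_ using (_∈?_)
open import Data.Product
open import Data.Sum using (_⊎_; inj₁; inj₂; [_,_]′)
open import Data.Empty using (⊥-elim)
open import Function using (_∘_)
open import Relation.Nullary using (¬_; yes; no)
open import Relation.Binary.Definitions using (tri<; tri≈; tri>)
open import Relation.Binary.PropositionalEquality
open import Function.Bundles using (_⇔_; mk⇔; Equivalence)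
open import Function.Construct.Composition using (_⇔-∘_)

infix 4 _∈[_,_]

_∈[_,_] : ℕ → ℕ → ℕ → Set
q ∈[ x , y ] = x ≤ q × q ≤ y

suc≢1 : ∀ {s} → 1 ≤ s → suc s ≢ 1
suc≢1 (s≤s z≤n) ()

<-rec-between : ∀ {k r} (P : ℕ → Set) →
  (∀ m → k < m → m ≤ r → (∀ m′ → k < m′ → m′ < m → P m′) → P m) →
  ∀ m → k < m → m ≤ r → P m
<-rec-between {k} {r} P next = <-rec (λ m → k < m → m ≤ r → P m) λ m ih k<m m≤r →
  next m k<m m≤r λ m′ k<m′ m′<m → ih m′<m k<m′ (<⇒≤ (<-≤-trans m′<m m≤r))

val-applyUpTo : ∀ (f : ℕ → ℕ) n p → p < n → val (applyUpTo f n) (suc p) ≡ f p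
val-applyUpTo f (suc n) zero    _         = refl
val-applyUpTo f (suc n) (suc p) (s≤s p<n) = val-applyUpTo (f ∘ suc) n p p<n

-- s_i acting on positions; the identity for i = 0, as is swapAt 0.
swapPos : ℕ → ℕ → ℕ
swapPos zero          q                   = q
swapPos (suc i)       zero                = zero
swapPos (suc zero)    (suc zero)          = 2
swapPos (suc zero)    (suc (suc zero))    = 1
swapPos (suc zero)    (suc (suc (suc q))) = suc (suc (suc q))
swapPos (suc (suc i)) (suc q)             = suc (swapPos (suc i) q)

swapPos-at : ∀ j → swapPos (suc j) (suc j) ≡ suc (suc j)
swapPos-at zero    = refl
swapPos-at (suc j) = cong suc (swapPos-at j)

swapPos-at-suc : ∀ j → swapPos (suc j) (suc (suc j)) ≡ suc j
swapPos-at-suc zero    = refl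
swapPos-at-suc (suc j) = cong suc (swapPos-at-suc j)

swapPos-elsewhere : ∀ j q → q ≢ suc j → q ≢ suc (suc j) → swapPos (suc j) q ≡ q
swapPos-elsewhere j       zero                _   _   = refl
swapPos-elsewhere zero    (suc zero)          q≢1 _   = ⊥-elim (q≢1 refl)
swapPos-elsewhere zero    (suc (suc zero))    _   q≢2 = ⊥-elim (q≢2 refl)
swapPos-elsewhere zero    (suc (suc (suc q))) _   _   = refl
swapPos-elsewhere (suc j) (suc q)             q≢i q≢i+1 =
  cong suc (swapPos-elsewhere j q (q≢i ∘ cong suc) (q≢i+1 ∘ cong suc))

data SwapPosView (i q : ℕ) : Set where
  moves-up   : q ≡ i     → swapPos i q ≡ suc i → SwapPosView i q
  moves-down : q ≡ suc i → swapPos i q ≡ i     → SwapPosView i q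
  stays      : swapPos i q ≡ q                 → SwapPosView i q

swapPos-view : ∀ {i} q → 1 ≤ i → SwapPosView i q
swapPos-view {suc j} q _ with q ≟ suc j | q ≟ suc (suc j)
... | yes refl | _        = moves-up refl (swapPos-at j)
... | no _     | yes refl = moves-down refl (swapPos-at-suc j)
... | no q≢i   | no q≢i+1 = stays (swapPos-elsewhere j q q≢i q≢i+1)

swapPos-involutive : ∀ {i} q → 1 ≤ i → swapPos i (swapPos i q) ≡ q
swapPos-involutive {suc j} q 1≤i with swapPos-view q 1≤i
... | moves-up refl e   = trans (cong (swapPos (suc j)) e) (swapPos-at-suc j)
... | moves-down refl e = trans (cong (swapPos (suc j)) e) (swapPos-at j)
... | stays e           = trans (cong (swapPos (suc j)) e) e

swapPos-∈[] : ∀ {s x y q} → 1 ≤ s → suc s ≢ x → s ≢ y → q ∈[ x , y ] → swapPos s q ∈[ x , y ]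
swapPos-∈[] {s} {x} {y} {q} 1≤s s+1≢x s≢y (x≤q , q≤y) with swapPos-view q 1≤s
... | moves-up refl e   rewrite e = m≤n⇒m≤1+n x≤q , ≤∧≢⇒< q≤y s≢y
... | moves-down refl e rewrite e = ≤-pred (≤∧≢⇒< x≤q (s+1≢x ∘ sym)) , ≤-trans (n≤1+n s) q≤y
... | stays e           rewrite e = x≤q , q≤y

val-swapAt : ∀ i u q → 1 ≤ i → suc i ≤ length u → val (swapAt i u) q ≡ val u (swapPos i q)
val-swapAt 1 (x ∷ y ∷ xs) zero                _ _ = refl
val-swapAt 1 (x ∷ y ∷ xs) (suc zero)          _ _ = refl
val-swapAt 1 (x ∷ y ∷ xs) (suc (suc zero))    _ _ = refl
val-swapAt 1 (x ∷ y ∷ xs) (suc (suc (suc q))) _ _ = refl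
val-swapAt 1 (x ∷ [])     q                   _ (s≤s ())
val-swapAt (suc (suc i)) (x ∷ xs) zero          _ _ = refl
val-swapAt (suc (suc i)) (x ∷ xs) (suc zero)    _ _ = refl
val-swapAt (suc (suc i)) (x ∷ xs) (suc (suc q)) _ (s≤s i+2≤|xs|)
  with val-swapAt (suc i) xs (suc q) (s≤s z≤n) i+2≤|xs| | swapPos-view {suc i} (suc q) (s≤s z≤n)
... | e | moves-up refl e′   rewrite e′ = e
... | e | moves-down refl e′ rewrite e′ = e
... | e | stays e′           rewrite e′ = e

length-swapAt : ∀ i u → length (swapAt i u) ≡ length u
length-swapAt zero          u            = refl
length-swapAt (suc zero)    []           = refl
length-swapAt (suc zero)    (x ∷ [])     = refl
length-swapAt (suc zero)    (x ∷ y ∷ xs) = refl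
length-swapAt (suc (suc i)) []           = refl
length-swapAt (suc (suc i)) (x ∷ xs)     = cong suc (length-swapAt (suc i) xs)

length-InCoset : ∀ {K v u} → InCoset K v u → length u ≡ length v
length-InCoset here                = refl
length-InCoset (step {u} {i} c _) = trans (length-swapAt i u) (length-InCoset c)

record ValuesAmong (w w′ : List ℕ) (x y : ℕ) : Set where
  constructor values-among
  field among : ∀ p → p ∈[ x , y ] → ∃ λ q → q ∈[ x , y ] × val w p ≡ val w′ q
open ValuesAmong

SameValuesOn : List ℕ → List ℕ → ℕ → ℕ → Set
SameValuesOn w w′ x y = ValuesAmong w w′ x y × ValuesAmong w′ w x y

ValuesAmong-trans : ∀ {u v w x y} → ValuesAmong u v x y → ValuesAmong v w x y → ValuesAmong u w x y
ValuesAmong-trans u⊆v v⊆w = values-among λ p p∈ →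
  let q , q∈ , e = among u⊆v p p∈
      o , o∈ , e′ = among v⊆w q q∈
  in o , o∈ , trans e e′

SameValuesOn-refl : ∀ {w x y} → SameValuesOn w w x y
SameValuesOn-refl = values-among (λ p p∈ → p , p∈ , refl) , values-among (λ p p∈ → p , p∈ , refl)

SameValuesOn-trans : ∀ {u v w x y} → SameValuesOn u v x y → SameValuesOn v w x y → SameValuesOn u w x y
SameValuesOn-trans (u⊆v , v⊆u) (v⊆w , w⊆v) = ValuesAmong-trans u⊆v v⊆w , ValuesAmong-trans w⊆v v⊆u

maximum-transfer : ∀ {w w′ x y a} → ValuesAmong w w′ x y → val w a ≡ val w′ a →
  (∀ q → x ≤ q → q ≤ y → val w′ q ≤ val w′ a) → ∀ p → x ≤ p → p ≤ y → val w p ≤ val w a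
maximum-transfer w⊆w′ wa≡w′a max p x≤p p≤y with among w⊆w′ p (x≤p , p≤y)
... | q , (x≤q , q≤y) , e = subst₂ _≤_ (sym e) (sym wa≡w′a) (max q x≤q q≤y)

minimum-transfer : ∀ {w w′ x y a} → ValuesAmong w w′ x y → val w a ≡ val w′ a →
  (∀ q → x ≤ q → q ≤ y → val w′ a ≤ val w′ q) → ∀ p → x ≤ p → p ≤ y → val w a ≤ val w p
minimum-transfer w⊆w′ wa≡w′a min p x≤p p≤y with among w⊆w′ p (x≤p , p≤y)
... | q , (x≤q , q≤y) , e = subst₂ _≤_ (sym wa≡w′a) (sym e) (min q x≤q q≤y)

swapAt-same-values : ∀ {i u x y} → 1 ≤ i → suc i ≤ length u → suc i ≢ x → i ≢ y →
  SameValuesOn (swapAt i u) u x y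
swapAt-same-values {i} {u} 1≤i i<|u| i+1≢x i≢y =
  values-among (λ p p∈ → swapPos i p , swapPos-∈[] 1≤i i+1≢x i≢y p∈ , val-swapAt i u p 1≤i i<|u|) ,
  values-among (λ q q∈ → swapPos i q , swapPos-∈[] 1≤i i+1≢x i≢y q∈ ,
     (begin
       val u q                             ≡⟨ cong (val u) (sym (swapPos-involutive q 1≤i)) ⟩
       val u (swapPos i (swapPos i q))     ≡⟨ sym (val-swapAt i u (swapPos i q) 1≤i i<|u|) ⟩
       val (swapAt i u) (swapPos i q)      ∎))
  where open ≡-Reasoning

-- Neither s_{x-1} nor s_y lies in K, so W_K maps the position interval [x, y] onto itself.
Preserves : List ℕ → ℕ → ℕ → Set
Preserves K x y = ∀ s → s ∈ K → suc s ≢ x × s ≢ y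

InCoset-same-values : ∀ {n K v u x y} → IsSubsetOfS n K → length v ≡ n → Preserves K x y →
  InCoset K v u → SameValuesOn u v x y
InCoset-same-values K⊆S |v|≡n pres here = SameValuesOn-refl
InCoset-same-values K⊆S |v|≡n pres (step {u} {i} c i∈K) =
  SameValuesOn-trans
    (swapAt-same-values (proj₁ (K⊆S i i∈K))
      (subst (suc i ≤_) (sym (trans (length-InCoset c) |v|≡n)) (proj₂ (K⊆S i i∈K)))
      (proj₁ (pres i i∈K)) (proj₂ (pres i i∈K)))
    (InCoset-same-values K⊆S |v|≡n pres c)

IsComponent⇒Preserves : ∀ {K a b} → IsComponent K a b → Preserves K a b
IsComponent⇒Preserves (_ , _ , a-1∉K , b∉K) s s∈K = (λ e → a-1∉K s e s∈K) , (λ { refl → b∉K s∈K })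

module _ {n : ℕ} {K : List ℕ} (K⊆S : IsSubsetOfS n K) where

  private
    extend-left : ∀ i → i ∈ K →
      ∃ λ a → a ≤ i × (∀ x → a ≤ x → x ≤ i → x ∈ K) × (∀ x → suc x ≡ a → ¬ x ∈ K)
    extend-left zero    i∈K = ⊥-elim (<⇒≱ (proj₁ (K⊆S zero i∈K)) z≤n)
    extend-left (suc i) i+1∈K with i ∈? K
    ... | no i∉K = suc i , ≤-refl , (λ x a≤x x≤i → subst (_∈ K) (≤-antisym a≤x x≤i) i+1∈K) ,
                   (λ x e x∈K → i∉K (subst (_∈ K) (suc-injective e) x∈K))
    ... | yes i∈K with extend-left i i∈K
    ...   | a , a≤i , run , a-1∉K = a , m≤n⇒m≤1+n a≤i ,
            (λ x a≤x x≤i+1 → [ (λ x<i+1 → run x a≤x (≤-pred x<i+1)) , (λ { refl → i+1∈K }) ]′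
                               (m≤n⇒m<n∨m≡n x≤i+1)) ,
            a-1∉K

    extend-right : ∀ fuel i → n ≤ fuel + i → i ∈ K →
      ∃ λ b → i < b × (∀ x → i ≤ x → x < b → x ∈ K) × ¬ b ∈ K
    extend-right fuel i _ i∈K with suc i ∈? K
    extend-right fuel i _ i∈K | no i+1∉K =
      suc i , ≤-refl , (λ x i≤x x<i+1 → subst (_∈ K) (≤-antisym i≤x (≤-pred x<i+1)) i∈K) , i+1∉K
    extend-right zero i n≤i i∈K | yes _ = ⊥-elim (<⇒≱ (proj₂ (K⊆S i i∈K)) n≤i)
    extend-right (suc fuel) i n≤fuel+i+1 i∈K | yes i+1∈K
      with extend-right fuel (suc i) (subst (n ≤_) (sym (+-suc fuel i)) n≤fuel+i+1) i+1∈K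
    ... | b , i+1<b , run , b∉K = b , <-trans ≤-refl i+1<b ,
          (λ x i≤x x<b → [ (λ i<x → run x i<x x<b) , (λ { refl → i∈K }) ]′ (m≤n⇒m<n∨m≡n i≤x)) ,
          b∉K

  component-containing : ∀ i → i ∈ K → ∃₂ λ a b → IsComponent K a b × a ≤ i × i < b
  component-containing i i∈K with extend-left i i∈K | extend-right n i (m≤m+n n i) i∈K
  ... | a , a≤i , left , a-1∉K | b , i<b , right , b∉K =
    a , b , (≤-<-trans a≤i i<b ,
             (λ x a≤x x<b → [ left x a≤x , (λ i≤x → right x i≤x x<b) ]′ (≤-total x i)) ,
             a-1∉K , b∉K) ,
    a≤i , i<b

  component-bounds : ∀ {a b} → IsComponent K a b → 1 ≤ a × b ≤ n
  component-bounds {a} {suc b} (a<b+1 , run , _ , _) =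
    proj₁ (K⊆S a (run a ≤-refl a<b+1)) , proj₂ (K⊆S b (run b (≤-pred a<b+1) ≤-refl))

Touches : List ℕ → ℕ → Set
Touches K q = ∃ λ s → s ∈ K × (s ≡ q ⊎ suc s ≡ q)

Descent : List ℕ → ℕ → Set
Descent w p = val w (suc p) < val w p

descending⇒below-start : ∀ {w i j} → (∀ p → i ≤ p → p < j → Descent w p) →
  ∀ q → i < q → q ≤ j → val w q < val w i
descending⇒below-start {w} desc (suc q) i<q+1 q<j with m≤n⇒m<n∨m≡n (≤-pred i<q+1)
... | inj₁ i<q = <-trans (desc q (<⇒≤ i<q) q<j) (descending⇒below-start {w} desc q i<q (<⇒≤ q<j))
... | inj₂ refl = desc q ≤-refl q<j

lambda⇒ascent : ∀ {w p} → 1 ≤ p → IsLambda w (suc p) (suc p) → ¬ Descent w p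
lambda⇒ascent 1≤p (_ , _ , max) desc = <⇒≱ desc (max _ 1≤p (n≤1+n _))

rho⇒ascent : ∀ {n w p} → suc p ≤ n → IsRho n w p p → ¬ Descent w p
rho⇒ascent p<n (_ , _ , min) desc = <⇒≱ desc (min _ (n≤1+n _) p<n)

module Chain (n r : ℕ) (J W : ℕ → List ℕ)
  (J⊆S : ∀ k → 1 ≤ k → k ≤ r → IsSubsetOfS n (J k))
  (chain : IsWChain n J r W)
  (strongSeq : IsStrongRightDescentSeq n J r W) where

  W-step : ∀ k → suc k ≤ r → InCoset (J (suc k)) (W k) (W (suc k))
  W-step k k<r = proj₁ (proj₂ chain (suc k) (s≤s z≤n) k<r)

  length-W : ∀ k → k ≤ r → length (W k) ≡ n
  length-W zero    _   = trans (cong length (proj₁ chain)) (length-applyUpTo suc n)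
  length-W (suc k) k<r = trans (length-InCoset (W-step k k<r)) (length-W k (<⇒≤ k<r))

  val-W0 : ∀ p → p < n → val (W 0) (suc p) ≡ suc p
  val-W0 p p<n = trans (cong (λ w → val w (suc p)) (proj₁ chain)) (val-applyUpTo suc n p p<n)

  PreservedBetween : ℕ → ℕ → ℕ → ℕ → Set
  PreservedBetween k l x y = ∀ m → k < m → m ≤ l → Preserves (J m) x y

  W-same-values : ∀ {x y} k l → k ≤ l → l ≤ r → PreservedBetween k l x y → SameValuesOn (W l) (W k) x y
  W-same-values k l k≤l l≤r pres with m≤n⇒m<n∨m≡n k≤l
  ... | inj₂ refl = SameValuesOn-refl
  W-same-values k zero    _ _   _    | inj₁ ()
  W-same-values k (suc l) _ l<r pres | inj₁ k<l+1 =
    SameValuesOn-trans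
      (InCoset-same-values (J⊆S (suc l) (s≤s z≤n) l<r) (length-W l (<⇒≤ l<r))
        (pres (suc l) k<l+1 ≤-refl) (W-step l l<r))
      (W-same-values k l (≤-pred k<l+1) (<⇒≤ l<r) (λ m k<m m≤l → pres m k<m (m≤n⇒m≤1+n m≤l)))

  Untouched : ℕ → ℕ → ℕ → Set
  Untouched k l q = ∀ m → k < m → m ≤ l → ¬ Touches (J m) q

  UntouchedOn : ℕ → ℕ → ℕ → Set
  UntouchedOn k a b = ∀ q → q ∈[ a , b ] → Untouched k r q

  untouched-refl : ∀ {k q} → Untouched k k q
  untouched-refl m k<m m≤k = ⊥-elim (<⇒≱ k<m m≤k)

  untouched-extend : ∀ {k l q} → Untouched k l q → ¬ Touches (J (suc l)) q → Untouched k (suc l) q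
  untouched-extend u t m k<m m≤l+1 with m≤n⇒m<n∨m≡n m≤l+1
  ... | inj₁ m<l+1 = u m k<m (≤-pred m<l+1)
  ... | inj₂ refl  = t

  W-val-untouched : ∀ {k l q} → k ≤ l → l ≤ r → Untouched k l q → val (W l) q ≡ val (W k) q
  W-val-untouched {k} {l} {q} k≤l l≤r u
    with among (proj₁ (W-same-values k l k≤l l≤r pres)) q (≤-refl , ≤-refl)
    where
    pres : PreservedBetween k l q q
    pres m k<m m≤l s s∈J =
      (λ e → u m k<m m≤l (s , s∈J , inj₂ e)) , (λ e → u m k<m m≤l (s , s∈J , inj₁ e))
  ... | q′ , (q≤q′ , q′≤q) , e = trans e (cong (val (W k)) (≤-antisym q′≤q q≤q′))

  touching-node : ∀ {m q} → 1 ≤ m → m ≤ r → Touches (J m) q →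
    ∃ λ f → InHeap J r f × lvl f ≡ m × InIval q f
  touching-node {m} {q} 1≤m m≤r (s , s∈J , s≡q⊎s+1≡q)
    with component-containing (J⊆S m 1≤m m≤r) s s∈J
  ... | a , b , comp , a≤s , s<b = node m a b , (1≤m , m≤r , comp) , refl , in-interval s≡q⊎s+1≡q
    where
    in-interval : s ≡ q ⊎ suc s ≡ q → InIval q (node m a b)
    in-interval (inj₁ refl) = a≤s , <⇒≤ s<b
    in-interval (inj₂ refl) = m≤n⇒m≤1+n a≤s , s<b

  node-touches : ∀ {f q} → InHeap J r f → InIval q f → Touches (J (lvl f)) q
  node-touches {node k i j} {q} (_ , _ , _ , run , _) (i≤q , q≤j) with m≤n⇒m<n∨m≡n q≤j
  ... | inj₁ q<j = q , run q i≤q q<j , inj₁ refl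
  node-touches {node k i zero}    (_ , _ , () , _) _ | inj₂ refl
  node-touches {node k i (suc j)} (_ , _ , i<j+1 , run , _) _ | inj₂ refl =
    j , run j (≤-pred i<j+1) ≤-refl , inj₂ refl

  untouched-by-heap : ∀ {k q} → Untouched k r q → ∀ f → InHeap J r f → k < lvl f → ¬ InIval q f
  untouched-by-heap u f f∈H k<f q∈f = u (lvl f) k<f (proj₁ (proj₂ f∈H)) (node-touches f∈H q∈f)

  heap-free⇒untouched : ∀ {k q} → (∀ f → InHeap J r f → k < lvl f → ¬ InIval q f) → Untouched k r q
  heap-free⇒untouched free m k<m m≤r t with touching-node (≤-trans (s≤s z≤n) k<m) m≤r t
  ... | f , f∈H , refl , q∈f = free f f∈H k<m q∈f

  module _ {k a b} (1≤k : 1 ≤ k) (k≤r : k ≤ r) (comp : IsComponent (J k) a b) where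

    private
      strong : IsStrongRightDescentInterval n (W k) a b
      strong = strongSeq k 1≤k k≤r a b comp

    component-descending : ∀ p → a ≤ p → p < b → Descent (W k) p
    component-descending = proj₂ (proj₂ (proj₂ (proj₁ strong)))

    component-left-max : ∀ q → 1 ≤ q → q ≤ a → val (W k) q ≤ val (W k) a
    component-left-max = proj₂ (proj₂ (proj₁ (proj₂ strong)))

    component-right-min : ∀ q → b ≤ q → q ≤ n → val (W k) b ≤ val (W k) q
    component-right-min = proj₂ (proj₂ (proj₂ (proj₂ strong)))

  descent-in-J : ∀ {k p} → 1 ≤ k → k ≤ r → p ∈ J k → Descent (W k) p
  descent-in-J {k} {p} 1≤k k≤r p∈J with component-containing (J⊆S k 1≤k k≤r) p p∈J
  ... | a , b , comp , a≤p , p<b = component-descending 1≤k k≤r comp p a≤p p<b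

  -- p + 1 is then the left end of its component, hence a prefix maximum.
  ascent-before-component : ∀ {k p} → 1 ≤ k → k ≤ r → 1 ≤ p → ¬ p ∈ J k → suc p ∈ J k →
    ¬ Descent (W k) p
  ascent-before-component {k} {p} 1≤k k≤r 1≤p p∉J p+1∈J desc
    with component-containing (J⊆S k 1≤k k≤r) (suc p) p+1∈J
  ... | a , b , comp@(_ , run , _ , _) , a≤p+1 , p+1<b with a≡p+1
    where
    a≡p+1 : a ≡ suc p
    a≡p+1 = ≤-antisym a≤p+1 (≮⇒≥ λ a<p+1 → p∉J (run p (≤-pred a<p+1) (<-trans (n<1+n p) p+1<b)))
  ... | refl = <⇒≱ desc (component-left-max 1≤k k≤r comp p 1≤p (n≤1+n p))

  -- p + 1 is then the right end of the component of s_p, hence a suffix minimum.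
  ascent-after-component : ∀ {k p} → 1 ≤ k → k ≤ r → suc (suc p) ≤ n → p ∈ J k → ¬ suc p ∈ J k →
    ¬ Descent (W k) (suc p)
  ascent-after-component {k} {p} 1≤k k≤r p+2≤n p∈J p+1∉J desc
    with component-containing (J⊆S k 1≤k k≤r) p p∈J
  ... | a , b , comp@(_ , run , _ , _) , a≤p , p<b with b≡p+1
    where
    b≡p+1 : b ≡ suc p
    b≡p+1 = ≤-antisym (≮⇒≥ λ p+1<b → p+1∉J (run (suc p) (m≤n⇒m≤1+n a≤p) p+1<b)) p<b
  ... | refl = <⇒≱ desc (component-right-min 1≤k k≤r comp (suc (suc p)) (n≤1+n _) p+2≤n)

  DescentCreatedAt : ℕ → ℕ → ℕ → Set
  DescentCreatedAt k l p = 1 ≤ k × k ≤ l × p ∈ J k × Untouched k l p × Untouched k l (suc p)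

  DescentCreated : ℕ → ℕ → Set
  DescentCreated l p = ∃ λ k → DescentCreatedAt k l p

  created-blocked : ∀ {l p} → ¬ p ∈ J (suc l) →
    Touches (J (suc l)) p ⊎ Touches (J (suc l)) (suc p) → ¬ DescentCreated (suc l) p
  created-blocked {l} p∉J t (k , _ , k≤l+1 , p∈J , u , u′) with m≤n⇒m<n∨m≡n k≤l+1
  ... | inj₁ k<l+1 = [ u (suc l) k<l+1 ≤-refl , u′ (suc l) k<l+1 ≤-refl ]′ t
  ... | inj₂ refl  = p∉J p∈J

  created-step : ∀ {l p} → ¬ Touches (J (suc l)) p → ¬ Touches (J (suc l)) (suc p) →
    DescentCreated l p ⇔ DescentCreated (suc l) p
  created-step {l} {p} t t′ = mk⇔ forward backward
    where
    forward : DescentCreated l p → DescentCreated (suc l) p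
    forward (k , 1≤k , k≤l , p∈J , u , u′) =
      k , 1≤k , m≤n⇒m≤1+n k≤l , p∈J , untouched-extend u t , untouched-extend u′ t′
    restrict : ∀ {k q} → Untouched k (suc l) q → Untouched k l q
    restrict u m k<m m≤l = u m k<m (m≤n⇒m≤1+n m≤l)
    backward : DescentCreated (suc l) p → DescentCreated l p
    backward (k , 1≤k , k≤l+1 , p∈J , u , u′) with m≤n⇒m<n∨m≡n k≤l+1
    ... | inj₁ k<l+1 = k , 1≤k , ≤-pred k<l+1 , p∈J , restrict u , restrict u′
    ... | inj₂ refl  = ⊥-elim (t (p , p∈J , inj₁ refl))

  descent-untouched-step : ∀ {l p} → suc l ≤ r → ¬ Touches (J (suc l)) p → ¬ Touches (J (suc l)) (suc p) →
    Descent (W (suc l)) p ⇔ Descent (W l) p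
  descent-untouched-step l<r t t′ = mk⇔ (subst₂ _<_ e′ e) (subst₂ _<_ (sym e′) (sym e))
    where
    e  = W-val-untouched (n≤1+n _) l<r (untouched-extend untouched-refl t)
    e′ = W-val-untouched (n≤1+n _) l<r (untouched-extend untouched-refl t′)

  descent⇔created : ∀ l → l ≤ r → ∀ p → 1 ≤ p → suc p ≤ n → Descent (W l) p ⇔ DescentCreated l p
  descent⇔created _ _ zero () _
  descent⇔created zero _ (suc p) _ p+1<n =
    mk⇔ (⊥-elim ∘ no-descent) λ { (k , 1≤k , k≤0 , _) → ⊥-elim (<⇒≱ 1≤k k≤0) }
    where
    no-descent : ¬ Descent (W 0) (suc p)
    no-descent d = <⇒≱ d (subst₂ _≤_ (sym (val-W0 p (<-trans (n<1+n p) p+1<n))) (sym (val-W0 (suc p) p+1<n))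
                                    (n≤1+n _))
  descent⇔created (suc l) l<r (suc p) _ p+1<n with suc p ∈? J (suc l)
  ... | yes p∈J =
    mk⇔ (λ _ → suc l , s≤s z≤n , ≤-refl , p∈J , untouched-refl , untouched-refl)
        (λ _ → descent-in-J (s≤s z≤n) l<r p∈J)
  ... | no p∉J with suc (suc p) ∈? J (suc l)
  ...   | yes p+1∈J =
    mk⇔ (⊥-elim ∘ ascent-before-component (s≤s z≤n) l<r (s≤s z≤n) p∉J p+1∈J)
        (⊥-elim ∘ created-blocked p∉J (inj₂ (_ , p+1∈J , inj₁ refl)))
  ...   | no p+1∉J with p ∈? J (suc l)
  ...     | yes p-1∈J =
    mk⇔ (⊥-elim ∘ ascent-after-component (s≤s z≤n) l<r p+1<n p-1∈J p∉J)
        (⊥-elim ∘ created-blocked p∉J (inj₁ (p , p-1∈J , inj₂ refl)))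
  ...     | no p-1∉J =
    created-step t t′ ⇔-∘
      (descent⇔created l (<⇒≤ l<r) (suc p) (s≤s z≤n) p+1<n ⇔-∘ descent-untouched-step l<r t t′)
    where
    t : ¬ Touches (J (suc l)) (suc p)
    t (_ , s∈J , inj₁ refl) = p∉J s∈J
    t (_ , s∈J , inj₂ refl) = p-1∉J s∈J
    t′ : ¬ Touches (J (suc l)) (suc (suc p))
    t′ (_ , s∈J , inj₁ refl) = p+1∉J s∈J
    t′ (_ , s∈J , inj₂ refl) = p∉J s∈J

  created-level-unique : ∀ {k k′ l p} → DescentCreatedAt k l p → DescentCreatedAt k′ l (suc p) → k ≡ k′
  created-level-unique {k} {k′} (_ , k≤l , p∈J , _ , u) (_ , k′≤l , p+1∈J , u′ , _) with <-cmp k k′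
  ... | tri< k<k′ _ _ = ⊥-elim (u k′ k<k′ k′≤l (_ , p+1∈J , inj₁ refl))
  ... | tri≈ _ k≡k′ _ = k≡k′
  ... | tri> _ _ k′<k = ⊥-elim (u′ k k′<k k≤l (_ , p∈J , inj₂ refl))

  descents-created-at-one-level : ∀ {a b} → IsRightDescentInterval n (W r) a b →
    ∃ λ k → ∀ p → a ≤ p → p < b → DescentCreatedAt k r p
  descents-created-at-one-level {a} {b} (a<b , 1≤a , b≤n , desc) = proj₁ created-a , same-level
    where
    created : ∀ {p} → a ≤ p → p < b → DescentCreated r p
    created {p} a≤p p<b =
      Equivalence.to (descent⇔created r ≤-refl p (≤-trans 1≤a a≤p) (≤-trans p<b b≤n)) (desc p a≤p p<b)
    created-a = created ≤-refl a<b
    same-level : ∀ p → a ≤ p → p < b → DescentCreatedAt (proj₁ created-a) r p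
    same-level p a≤p p<b with m≤n⇒m<n∨m≡n a≤p
    ... | inj₂ refl = proj₂ created-a
    same-level zero    _ _     | inj₁ ()
    same-level (suc p) _ p+1<b | inj₁ a<p+1 with created (<⇒≤ a<p+1) p+1<b
    ... | k′ , c = subst (λ k → DescentCreatedAt k r (suc p))
                         (sym (created-level-unique (same-level p (≤-pred a<p+1) (<-trans (n<1+n p) p+1<b)) c)) c

  created⇒untouched-on : ∀ {k a b} → a < b → (∀ p → a ≤ p → p < b → DescentCreatedAt k r p) →
    UntouchedOn k a b
  created⇒untouched-on {b = suc b} a<b+1 created q (a≤q , q≤b+1) with m≤n⇒m<n∨m≡n q≤b+1
  ... | inj₁ q<b+1 = let (_ , _ , _ , u , _) = created q a≤q q<b+1 in u
  ... | inj₂ refl  = let (_ , _ , _ , _ , u) = created b (≤-pred a<b+1) ≤-refl in u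

  HeapWitness : ℕ → ℕ → Set
  HeapWitness a b = ∃ λ e → InHeap J r e × ival e ≤ a × b ≤ jval e × UntouchedOn (lvl e) a b

  descent-interval⇒witness : ∀ {a b} → IsRightDescentInterval n (W r) a b → HeapWitness a b
  descent-interval⇒witness {a} {b} rdi@(a<b , _) with descents-created-at-one-level rdi
  ... | k , created with created a ≤-refl a<b
  ...   | 1≤k , k≤r , a∈J , _ with component-containing (J⊆S k 1≤k k≤r) a a∈J
  ...     | i , j , comp@(_ , _ , _ , j∉J) , i≤a , a<j =
    node k i j , (1≤k , k≤r , comp) , i≤a , b≤j , created⇒untouched-on a<b created
    where
    b≤j : b ≤ j
    b≤j = ≮⇒≥ λ j<b → let (_ , _ , j∈J , _) = created j (<⇒≤ a<j) j<b in j∉J j∈J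

  witness⇒descent-interval : ∀ {a b} → a < b → HeapWitness a b → IsRightDescentInterval n (W r) a b
  witness⇒descent-interval {a} {b} a<b (node k i j , (1≤k , k≤r , comp) , i≤a , b≤j , u)
    with component-bounds (J⊆S k 1≤k k≤r) comp
  ... | 1≤i , j≤n = a<b , 1≤a , b≤n , λ p a≤p p<b →
    Equivalence.from (descent⇔created r ≤-refl p (≤-trans 1≤a a≤p) (≤-trans p<b b≤n))
      (k , 1≤k , k≤r , proj₁ (proj₂ comp) p (≤-trans i≤a a≤p) (<-≤-trans p<b b≤j) ,
       u p (a≤p , <⇒≤ p<b) , u (suc p) (m≤n⇒m≤1+n a≤p , p<b))
    where
    1≤a = ≤-trans 1≤i i≤a
    b≤n = ≤-trans b≤j j≤n

  lambda-untouched : ∀ {k a} → k ≤ r → Untouched k r a → IsLambda (W r) a a ⇔ IsLambda (W k) a a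
  lambda-untouched {k} {a} k≤r u =
    mk⇔ (λ (1≤a , a≤a , max) → 1≤a , a≤a , maximum-transfer (proj₂ same) (sym e) max)
        (λ (1≤a , a≤a , max) → 1≤a , a≤a , maximum-transfer (proj₁ same) e max)
    where
    same : SameValuesOn (W r) (W k) 1 a
    same = W-same-values k r k≤r ≤-refl λ m k<m m≤r s s∈J →
      suc≢1 (proj₁ (J⊆S m (≤-trans (s≤s z≤n) k<m) m≤r s s∈J)) ,
      (λ s≡a → u m k<m m≤r (s , s∈J , inj₁ s≡a))
    e : val (W r) a ≡ val (W k) a
    e = W-val-untouched k≤r ≤-refl u

  rho-untouched : ∀ {k b} → k ≤ r → Untouched k r b → IsRho n (W r) b b ⇔ IsRho n (W k) b b
  rho-untouched {k} {b} k≤r u =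
    mk⇔ (λ (b≤b , b≤n , min) → b≤b , b≤n , minimum-transfer (proj₂ same) (sym e) min)
        (λ (b≤b , b≤n , min) → b≤b , b≤n , minimum-transfer (proj₁ same) e min)
    where
    same : SameValuesOn (W r) (W k) b n
    same = W-same-values k r k≤r ≤-refl λ m k<m m≤r s s∈J →
      (λ s+1≡b → u m k<m m≤r (s , s∈J , inj₂ s+1≡b)) ,
      <⇒≢ (proj₂ (J⊆S m (≤-trans (s≤s z≤n) k<m) m≤r s s∈J))
    e : val (W r) b ≡ val (W k) b
    e = W-val-untouched k≤r ≤-refl u

  NoShiftWitness : ℕ → ℕ → Set
  NoShiftWitness a b = ∃ λ e → InHeap J r e × ¬ U1Exists J r e × ¬ U2Exists J r e × ival e ≡ a × jval e ≡ b

  module _ {k i j} (1≤k : 1 ≤ k) (k≤r : k ≤ r) (comp : IsComponent (J k) i j) where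

    private
      run : ∀ p → i ≤ p → p < j → p ∈ J k
      run = proj₁ (proj₂ comp)
      bounds = component-bounds (J⊆S k 1≤k k≤r) comp

    -- Otherwise s_b ∈ J k makes b a descent of W k, against the suffix minimum at b.
    right-end-exact : ∀ {b} → i ≤ b → b ≤ j → Untouched k r b → IsRho n (W r) b b → j ≡ b
    right-end-exact {b} i≤b b≤j u rho = ≤-antisym (≮⇒≥ b≮j) b≤j
      where
      b≮j : ¬ b < j
      b≮j b<j = rho⇒ascent {w = W k} (≤-trans b<j (proj₂ bounds)) (Equivalence.to (rho-untouched k≤r u) rho)
                           (descent-in-J 1≤k k≤r (run b i≤b b<j))

    -- Otherwise s_{a-1} ∈ J k makes a - 1 a descent of W k, against the prefix maximum at a.
    left-end-exact : ∀ {a} → i ≤ a → a ≤ j → Untouched k r a → IsLambda (W r) a a → i ≡ a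
    left-end-exact {a} i≤a a≤j u lam =
      ≤-antisym i≤a (≮⇒≥ (i≮a a≤j (Equivalence.to (lambda-untouched k≤r u) lam)))
      where
      i≮a : ∀ {a} → a ≤ j → IsLambda (W k) a a → ¬ i < a
      i≮a {suc a′} a≤j lamₖ (s≤s i≤a′) =
        lambda⇒ascent {w = W k} (≤-trans (proj₁ bounds) i≤a′) lamₖ
                      (descent-in-J 1≤k k≤r (run a′ i≤a′ a≤j))

  strong⇒no-shift-witness : ∀ {a b} → IsStrongRightDescentInterval n (W r) a b → NoShiftWitness a b
  strong⇒no-shift-witness {a} {b} (rdi@(a<b , _) , lam , rho) with descent-interval⇒witness rdi
  ... | node k i j , e∈H@(1≤k , k≤r , comp) , i≤a , b≤j , u
    with left-end-exact 1≤k k≤r comp i≤a (≤-trans (<⇒≤ a<b) b≤j) (u a (≤-refl , <⇒≤ a<b)) lam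
       | right-end-exact 1≤k k≤r comp (≤-trans i≤a (<⇒≤ a<b)) b≤j (u b (<⇒≤ a<b , ≤-refl)) rho
  ... | refl | refl =
    node k i j , e∈H , no-shift-at (<⇒≤ a<b , ≤-refl) , no-shift-at (≤-refl , <⇒≤ a<b) , refl , refl
    where
    no-shift-at : ∀ {q} → q ∈[ i , j ] → ¬ ∃ λ h → IsShiftAt J r q (node k i j) h
    no-shift-at q∈ (h , h∈H , k<h , q∈h , _) = untouched-by-heap (u _ q∈) h h∈H k<h q∈h

  -- The lowest level above lvl e touching q would be e shifted at q.
  no-shift⇒untouched : ∀ {e q} → ¬ (∃ λ h → IsShiftAt J r q e h) → Untouched (lvl e) r q
  no-shift⇒untouched {e} {q} no-shift = <-rec-between (λ m → ¬ Touches (J m) q) lowest-touch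
    where
    lowest-touch : ∀ m → lvl e < m → m ≤ r → (∀ m′ → lvl e < m′ → m′ < m → ¬ Touches (J m′) q) →
      ¬ Touches (J m) q
    lowest-touch m e<m m≤r lower t with touching-node (≤-trans (s≤s z≤n) e<m) m≤r t
    ... | h , h∈H , refl , q∈h =
      no-shift (h , h∈H , e<m , q∈h , λ g g∈H e<g g<h q∈g → lower (lvl g) e<g g<h (node-touches g∈H q∈g))

  preserved-one-level : ∀ {l x y} → Preserves (J (suc l)) x y → PreservedBetween l (suc l) x y
  preserved-one-level pres m l<m m≤l+1 with ≤-antisym m≤l+1 l<m
  ... | refl = pres

  -- A component [i′, j′] at level m strictly inside [i, j] would have at its left end i′ a
  -- value of W (m - 1) from [i′, j′], which W k already held; W k decreases on [i, j], so that
  -- value lies below W k i = W m i, contradicting that i′ is a prefix maximum of W m.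
  nested-touch-impossible : ∀ {k i j m} → 1 ≤ k → k ≤ r → IsComponent (J k) i j → k < m → m ≤ r →
    Untouched k r i → Untouched k r j →
    (∀ m′ → k < m′ → m′ < m → ∀ q → q ∈[ i , j ] → ¬ Touches (J m′) q) →
    ∀ q → q ∈[ i , j ] → ¬ Touches (J m) q
  nested-touch-impossible {k} {i} {j} {suc m₀} 1≤k k≤r comp k<m m≤r ui uj lower q (i≤q , q≤j) t
    with touching-node (s≤s z≤n) m≤r t
  ... | node _ i′ j′ , f∈H@(_ , _ , comp′) , refl , (i′≤q , q≤j′)
    with among (proj₁ (W-same-values m₀ (suc m₀) (n≤1+n m₀) m≤r
                         (preserved-one-level (IsComponent⇒Preserves comp′))))
               i′ (≤-refl , ≤-trans i′≤q q≤j′)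
  ... | q″ , (i′≤q″ , q″≤j′) , W-i′≡W₀-q″ = <-irrefl refl (begin-strict
    val (W k) i         ≡⟨ sym i-kept ⟩
    val (W (suc m₀)) i  ≤⟨ component-left-max (s≤s z≤n) m≤r comp′ i 1≤i (<⇒≤ i<i′) ⟩
    val (W (suc m₀)) i′ ≡⟨ W-i′≡W₀-q″ ⟩
    val (W m₀) q″       ≡⟨ q″-kept ⟩
    val (W k) q″        <⟨ descending⇒below-start {w = W k} (component-descending 1≤k k≤r comp)
                                                    q″ i<q″ q″≤j ⟩
    val (W k) i         ∎)
    where
    open ≤-Reasoning
    1≤i = proj₁ (component-bounds (J⊆S k 1≤k k≤r) comp)
    i<i′ : i < i′
    i<i′ = ≰⇒> λ i′≤i → ui (suc m₀) k<m m≤r (node-touches f∈H (i′≤i , ≤-trans i≤q q≤j′))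
    j′<j : j′ < j
    j′<j = ≰⇒> λ j≤j′ → uj (suc m₀) k<m m≤r (node-touches f∈H (≤-trans i′≤q q≤j , j≤j′))
    i<q″ = <-≤-trans i<i′ i′≤q″
    q″≤j = <⇒≤ (≤-<-trans q″≤j′ j′<j)
    i-kept : val (W (suc m₀)) i ≡ val (W k) i
    i-kept = W-val-untouched (<⇒≤ k<m) m≤r λ m′ k<m′ m′≤m → ui m′ k<m′ (≤-trans m′≤m m≤r)
    q″-kept : val (W m₀) q″ ≡ val (W k) q″
    q″-kept = W-val-untouched (≤-pred k<m) (<⇒≤ m≤r) λ m′ k<m′ m′≤m₀ →
      lower m′ k<m′ (s≤s m′≤m₀) q″ (<⇒≤ i<q″ , q″≤j)

  untouched-interior : ∀ {k i j} → 1 ≤ k → k ≤ r → IsComponent (J k) i j →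
    Untouched k r i → Untouched k r j → UntouchedOn k i j
  untouched-interior {i = i} {j = j} 1≤k k≤r comp ui uj q q∈ m k<m m≤r =
    <-rec-between (λ m → ∀ q → q ∈[ i , j ] → ¬ Touches (J m) q)
      (λ m k<m m≤r lower → nested-touch-impossible 1≤k k≤r comp k<m m≤r ui uj lower)
      m k<m m≤r q q∈

  no-shift-witness⇒strong : ∀ {a b} → a < b → NoShiftWitness a b → IsStrongRightDescentInterval n (W r) a b
  no-shift-witness⇒strong a<b (node k i j , e∈H@(1≤k , k≤r , comp) , ¬u1 , ¬u2 , refl , refl)
    with component-bounds (J⊆S k 1≤k k≤r) comp
  ... | 1≤i , j≤n =
    witness⇒descent-interval a<b
      (node k i j , e∈H , ≤-refl , ≤-refl , untouched-interior 1≤k k≤r comp ui uj) ,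
    Equivalence.from (lambda-untouched k≤r ui) (1≤i , ≤-refl , component-left-max 1≤k k≤r comp) ,
    Equivalence.from (rho-untouched k≤r uj) (≤-refl , j≤n , component-right-min 1≤k k≤r comp)
    where
    ui : Untouched k r i
    ui = no-shift⇒untouched {node k i j} ¬u2
    uj : Untouched k r j
    uj = no-shift⇒untouched {node k i j} ¬u1

  untouched-on⇔heap-clear : ∀ {k a b} →
    UntouchedOn k a b ⇔ (∀ f → InHeap J r f → k < lvl f → ∀ p → a ≤ p → p ≤ b → ¬ InIval p f)
  untouched-on⇔heap-clear =
    mk⇔ (λ u f f∈H k<f p a≤p p≤b → untouched-by-heap (u p (a≤p , p≤b)) f f∈H k<f)
        (λ clear q (a≤q , q≤b) → heap-free⇒untouched λ f f∈H k<f → clear f f∈H k<f q a≤q q≤b)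

mainTheorem5 : (n r : ℕ) (J : ℕ → List ℕ) (W : ℕ → List ℕ) →
    (∀ k → 1 ≤ k → k ≤ r → IsSubsetOfS n (J k)) →
    IsWChain n J r W →
    IsStrongRightDescentSeq n J r W →
    ∀ a b → a < b →
      (IsRightDescentInterval n (W r) a b ⇔
        ∃ λ e → InHeap J r e × ival e ≤ a × b ≤ jval e ×
          (∀ f → InHeap J r f → lvl e < lvl f →
            ∀ p → a ≤ p → p ≤ b → ¬ InIval p f))
      ×
      (IsStrongRightDescentInterval n (W r) a b ⇔
        ∃ λ e → InHeap J r e × ¬ U1Exists J r e × ¬ U2Exists J r e ×
          ival e ≡ a × jval e ≡ b)
mainTheorem5 n r J W J⊆S chain strongSeq a b a<b =
  mk⇔ (map-clear (Equivalence.to untouched-on⇔heap-clear) ∘ descent-interval⇒witness)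
      (witness⇒descent-interval a<b ∘ map-clear (Equivalence.from untouched-on⇔heap-clear)) ,
  mk⇔ strong⇒no-shift-witness (no-shift-witness⇒strong a<b)
  where
  open Chain n r J W J⊆S chain strongSeq
  map-clear : ∀ {A B : ℕ → Set} → (∀ {k} → A k → B k) →
    (∃ λ e → InHeap J r e × ival e ≤ a × b ≤ jval e × A (lvl e)) →
    (∃ λ e → InHeap J r e × ival e ≤ a × b ≤ jval e × B (lvl e))
  map-clear g (e , e∈H , i≤a , b≤j , x) = e , e∈H , i≤a , b≤j , g x
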